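{- Let $p\geq 3$ be a prime and let $M_p$ be the $p^2\times p^2$ matrix over $\mathbb{Z}_p$ defined below. Then $M_p$ has the following three properties: (1) every element of $\mathbb{Z}_p$ occurs exactly $p$ times in each row and exactly $p$ times in each column of $M_p$; (2) for every $i\in\mathbb{Z}_p$, any two distinct columns of the block $V_i$ have equal entries in exactly $p$ rows; (3) for all $0\leq i<j\leq p-1$, any column of $V_i$ and any column of $V_j$ have equal entries in exactly $p-1$ rows. Consequently, a GBTD$(p,p)$ can be obtained from $M_p$: taking the $p^2$ columns of $M_p$ as points, the $p\times(p^2-1)$ array whose cell in row $k\in\mathbb{Z}_p$ and column $r\in\{2,\dots,p^2\}$ is $\{c : (M_p)_{r,c}=k\}$ is a GBTD$(p,p)$. In particular, a GBTD$(p,p)$ exists for every prime $p\geq 3$.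
   Context: Throughout, $p\geq 3$ is a prime, $\mathbb{Z}_p$ is the field of integers modulo $p$ with elements represented by $0,\dots,p-1$ (so inequalities between elements refer to these representatives), and $+,\times$ denote operations in $\mathbb{Z}_p$. A $(v,k,\lambda)$-BIBD is a pair $(X,A)$ with $|X|=v$ and $A$ a collection of $k$-subsets (blocks) of $X$ such that every pair of distinct points lies in exactly $\lambda$ blocks. A GBTD$(k,m)$ (generalized balanced tournament design) is a $(km,k,k-1)$-BIBD $(X,A)$ whose $m(km-1)$ blocks can be arranged into an $m\times(km-1)$ array such that (i) every point of $X$ occurs in exactly one cell of each column, and (ii) every point of $X$ is contained in at most $k$ cells of each row. Notation: for $a\in\mathbb{Z}_p$, $\bar a$ denotes the length-$p$ vector $(a,a,\dots,a)$ and $\vec a$ the length-$p$ vector $(a,a+1,a+2,\dots,a+p-1)$. Definition of $M_p$: its $p^2$ columns are split into $p$ consecutive blocks $V_0,V_1,\dots,V_{p-1}$ of $p$ columns each (columns within each block indexed by $\mathbb{Z}_p$). Its $p^2$ rows are split into a first block $H^*$ of $p$ rows, indexed by $i\in\mathbb{Z}_p$, followed by blocks $H_0,H_1,\dots,H_{p-1}$ of $p-1$ rows each, the rows of each $H_i$ indexed by $l\in\{0,1,\dots,p-2\}$. Writing $(H_i,V_j)_l$ for the length-$p$ vector formed by row $l$ of $H_i$ restricted to the columns of $V_j$, the entries are: - row $i$ of $H^*$ is $(\bar i,\overline{i+1},\overline{i+2},\dots,\overline{i+p-1})$ (the $t$-th constant vector occupying block $V_t$); - for $i\in\mathbb{Z}_p$,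 $j\in\{0,\dots,p-2\}$, $l\in\{0,\dots,p-2\}$: $(H_i,V_j)_l=\overrightarrow{i\times(j+1)+j\times l}$; - for $i\in\mathbb{Z}_p$, $l\in\{0,\dots,p-2\}$: $(H_i,V_{p-1})_l=\overrightarrow{ -l}$ if $l\geq i$, and $(H_i,V_{p-1})_l=\overrightarrow{ -l+1}$ if $l<i$. Rows of $M_p$ are numbered $1,\dots,p^2$ from top (row 1 is row $0$ of $H^*$). -}

module Defs where

open import Data.Nat using (ℕ; zero; suc; _+_; _*_; _∸_; _<ᵇ_; _≤ᵇ_; _≤_; NonZero)
open import Data.Nat.DivMod using (_/_; _%_; _mod_)
open import Data.Bool using (Bool; true; false; if_then_else_; _∧_)
open import Data.Fin using (Fin; toℕ; combine; _<_)
open import Data.Fin.Subset using (Subset; ∣_∣)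
open import Data.Fin.Subset.Properties using (_∈?_)
open import Data.Vec using (tabulate)
open import Data.Product using (_×_; Σ)
open import Relation.Nullary.Decidable using (⌊_⌋)
open import Relation.Binary.PropositionalEquality using (_≡_; _≢_)
import Data.Fin as F

count : ∀ {n} → (Fin n → Bool) → ℕ
count {zero}  f = 0
count {suc n} f = (if f Fin.zero then 1 else 0) + count (λ i → f (Fin.suc i))

sumF : ∀ {n} → (Fin n → ℕ) → ℕ
sumF {zero}  f = 0
sumF {suc n} f = f Fin.zero + sumF (λ i → f (Fin.suc i))

-- Rows r and columns c are 0-indexed naturals
-- (row r here = row r+1 in the paper's numbering).  Columns: c = p*j + t
-- with j the block V_j and t ∈ Z_p the column inside V_j.
-- Rows: r < p is row r of H*; otherwise r = p + (p-1)*i + l is row l of H_i.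
-- The value is the representative in {0..p-1}, computed before reduction mod p.
-- (For p < 2 the matrix is irrelevant and set to 0.)

rawEntry : ℕ → ℕ → ℕ → ℕ
rawEntry (suc (suc q)) r c =
  let p = suc (suc q)
      j = c / p
      t = c % p
  in if r <ᵇ p then r + j
     else (let r' = r ∸ p
               i  = r' / suc q
               l  = r' % suc q
           in if j <ᵇ suc q then i * (j + 1) + j * l + t
              else (if i ≤ᵇ l then (p ∸ l) + t                 -- -l + t
                    else (p ∸ l) + 1 + t))                     -- -l + 1 + t
rawEntry _ r c = 0

entry : (p : ℕ) .{{_ : NonZero p}} → ℕ → ℕ → Fin p
entry p r c = rawEntry p r c mod p

M : (p : ℕ) .{{_ : NonZero p}} → Fin (p * p) → Fin (p * p) → Fin p
M p r c = entry p (toℕ r) (toℕ c)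

col : ∀ {p} → Fin p → Fin p → Fin (p * p)
col j t = combine j t

-- GBTD(k,m): a (km,k,k-1)-BIBD on the point set Fin (k*m) whose
-- m(km-1) blocks are arranged in an m × (km-1) array.

Array : ℕ → ℕ → Set
Array k m = Fin m → Fin (k * m ∸ 1) → Subset (k * m)

record IsGBTD (k m : ℕ) (A : Array k m) : Set where
  field
    blockSize : ∀ a b → ∣ A a b ∣ ≡ k
    balanced  : ∀ x y → x ≢ y →
                sumF (λ a → count (λ b → ⌊ x ∈? A a b ⌋ ∧ ⌊ y ∈? A a b ⌋)) ≡ k ∸ 1
    column    : ∀ b x → count (λ a → ⌊ x ∈? A a b ⌋) ≡ 1
    row       : ∀ a x → count (λ b → ⌊ x ∈? A a b ⌋) ≤ k

GBTD-exists : ℕ → ℕ → Set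
GBTD-exists k m = Σ (Array k m) (IsGBTD k m)

-- The array obtained from M_p: cell (k, s) with k ∈ Z_p and s ∈ Fin (p²-1)
-- corresponds to matrix row s+2 (1-indexed), i.e. 0-indexed row s+1, and is
-- the set of columns c with (M_p)_{row,c} = k.
arrayOf : (p : ℕ) .{{_ : NonZero p}} → Array p p
arrayOf p k s = tabulate (λ c → ⌊ entry p (suc (toℕ s)) (toℕ c) F.≟ k ⌋)

-- Work with the natural-number representatives of the entries, modulo p.  Restricted to a block V_j, a row of M_p is
-- constant (rows of H*) or a translate of (0, 1, …, p - 1), which gives the row counts.  Down a column of V_j with
-- j < p - 1, the entry in row l of H_a is affine in a with slope j + 1 ≢ 0, so every value occurs once per l; in
-- V_{p-1} the entry is t + 1 - (l + [a ≤ l]), so H_a misses exactly the value t + 1 - a.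
-- Two columns of one block agree exactly on H*.  Columns of V_i and V_j, i < j < p - 1, agree in row l of H_a for
-- exactly one a.  Against V_{p-1}, adding l turns agreement into (a + l)(i + 1) + t ≡ t' + [l < a], that is
-- a + l ≡ w when a ≤ l and a + l ≡ w' otherwise.  The number of pairs a ≤ l < p - 1 with a + l ≡ w is (p - 1)/2 for
-- every w, so w may be replaced by w', after which every l contributes exactly one a.
-- The array uses every row of M_p but the first, and two points share a cell of the array column coming from row r
-- iff their columns agree in row r; in the omitted first row, columns agree iff they lie in the same block.

module Submission where

module Mp where

  open import Data.Bool using (Bool; true; false; if_then_else_; _∧_; not)
  open import Data.Bool.Properties using (∧-idem)
  open import Data.Empty using (⊥-elim)
  import Data.Fin as Fin
  open import Data.Fin using (Fin; toℕ; remQuot)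
  import Data.Fin.Properties as Fin
  open import Data.Fin.Subset using (∣_∣)
  open import Data.Fin.Subset.Properties using (_∈?_)
  open import Data.Nat
  open import Data.Nat.DivMod
  open import Data.Nat.Divisibility using (divides; m%n≡0⇒n∣m; n∣m⇒m%n≡0)
  open import Data.Nat.Primality using (Prime; euclidsLemma)
  open import Data.Nat.Properties
  open import Algebra.Properties.CommutativeSemigroup +-commutativeSemigroup using (interchange)
  open import Data.Nat.Tactic.RingSolver using (solve-∀)
  open import Data.Product using (Σ-syntax; _×_; _,_; proj₁; proj₂)
  open import Data.Sum using (inj₁; inj₂; [_,_]′)
  open import Data.Vec using (tabulate)
  open import Function using (_∘_; _⇔_; mk⇔; Equivalence)
  open import Level using (0ℓ)
  open import Relation.Binary.Bundles using (Setoid)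
  open import Relation.Binary.Definitions using (tri<; tri≈; tri>)
  open import Relation.Binary.PropositionalEquality
  import Relation.Binary.Reasoning.Setoid as SetoidReasoning
  open import Relation.Nullary using (Dec; does; yes; no; ¬_)
  open import Relation.Nullary.Decidable using (⌊_⌋; dec-true; dec-false; does-⇔; map′; isYes≗does; ⌊⌋-map′)
  open import Defs using (count; sumF; rawEntry; M; col; arrayOf; IsGBTD)

  does⇒ : ∀ {P : Set} (P? : Dec P) → does P? ≡ true → P
  does⇒ (yes p) _ = p

  ∑ : ℕ → (ℕ → ℕ) → ℕ
  ∑ zero    f = 0
  ∑ (suc n) f = f 0 + ∑ n (λ k → f (suc k))

  syntax ∑ n (λ k → e) = ∑[ k < n ] e

  boolToℕ : Bool → ℕ
  boolToℕ b = if b then 1 else 0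

  # : ℕ → (ℕ → Bool) → ℕ
  # n b = ∑[ k < n ] boolToℕ (b k)

  syntax # n (λ k → b) = #[ k < n ] b

  ∑-cong : ∀ n {f g : ℕ → ℕ} → (∀ k → k < n → f k ≡ g k) → ∑ n f ≡ ∑ n g
  ∑-cong zero    f≗g = refl
  ∑-cong (suc n) f≗g = cong₂ _+_ (f≗g 0 z<s) (∑-cong n (λ k k<n → f≗g (suc k) (s<s k<n)))

  #-cong : ∀ n {f g : ℕ → Bool} → (∀ k → k < n → f k ≡ g k) → # n f ≡ # n g
  #-cong n f≗g = ∑-cong n (λ k k<n → cong boolToℕ (f≗g k k<n))

  ∑-zeros : ∀ n {f : ℕ → ℕ} → (∀ k → k < n → f k ≡ 0) → ∑ n f ≡ 0
  ∑-zeros n f≗0 = trans (∑-cong n f≗0) (zeros n)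
    where
    zeros : ∀ n → ∑[ k < n ] 0 ≡ 0
    zeros zero    = refl
    zeros (suc n) = zeros n

  ∑-ones : ∀ n {f : ℕ → ℕ} → (∀ k → k < n → f k ≡ 1) → ∑ n f ≡ n
  ∑-ones n f≗1 = trans (∑-cong n f≗1) (ones n)
    where
    ones : ∀ n → ∑[ k < n ] 1 ≡ n
    ones zero    = refl
    ones (suc n) = cong suc (ones n)

  ∑-++ : ∀ m n (f : ℕ → ℕ) → ∑ (m + n) f ≡ ∑ m f + ∑[ k < n ] f (m + k)
  ∑-++ zero    n f = refl
  ∑-++ (suc m) n f = trans (cong (f 0 +_) (∑-++ m n (λ k → f (suc k)))) (sym (+-assoc (f 0) _ _))

  ∑-init-last : ∀ n (f : ℕ → ℕ) → ∑ (suc n) f ≡ ∑ n f + f n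
  ∑-init-last n f = begin
    ∑ (suc n) f                   ≡⟨ cong (λ m → ∑ m f) (+-comm 1 n) ⟩
    ∑ (n + 1) f                   ≡⟨ ∑-++ n 1 f ⟩
    ∑ n f + (f (n + 0) + 0)       ≡⟨ cong (λ x → ∑ n f + (f x + 0)) (+-identityʳ n) ⟩
    ∑ n f + (f n + 0)             ≡⟨ cong (∑ n f +_) (+-identityʳ (f n)) ⟩
    ∑ n f + f n                   ∎
    where open ≡-Reasoning

  ∑-distrib-+ : ∀ n (f g : ℕ → ℕ) → ∑[ k < n ] (f k + g k) ≡ ∑ n f + ∑ n g
  ∑-distrib-+ zero    f g = refl
  ∑-distrib-+ (suc n) f g = begin
    f 0 + g 0 + ∑[ k < n ] (f (suc k) + g (suc k))  ≡⟨ cong (f 0 + g 0 +_) (∑-distrib-+ n _ _) ⟩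
    f 0 + g 0 + (F + G)                              ≡⟨ interchange (f 0) (g 0) F G ⟩
    f 0 + F + (g 0 + G)                              ∎
    where
    open ≡-Reasoning
    F = ∑[ k < n ] f (suc k)
    G = ∑[ k < n ] g (suc k)

  ∑-comm : ∀ m n (f : ℕ → ℕ → ℕ) → ∑[ i < m ] ∑[ j < n ] f i j ≡ ∑[ j < n ] ∑[ i < m ] f i j
  ∑-comm zero    n f = sym (∑-zeros n (λ _ _ → refl))
  ∑-comm (suc m) n f = trans (cong (∑[ j < n ] f 0 j +_) (∑-comm m n (λ i → f (suc i))))
                             (sym (∑-distrib-+ n (f 0) (λ j → ∑[ i < m ] f (suc i) j)))

  ∑-blocks : ∀ m n (f : ℕ → ℕ) → ∑ (m * n) f ≡ ∑[ j < m ] ∑[ t < n ] f (n * j + t)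
  ∑-blocks zero    n f = refl
  ∑-blocks (suc m) n f = begin
    ∑ (n + m * n) f                                             ≡⟨ ∑-++ n (m * n) f ⟩
    ∑ n f + ∑[ k < m * n ] f (n + k)                            ≡⟨ cong₂ _+_ first rest ⟩
    ∑[ t < n ] f (n * 0 + t) + ∑[ j < m ] ∑[ t < n ] f (n * suc j + t)  ∎
    where
    open ≡-Reasoning
    first : ∑ n f ≡ ∑[ t < n ] f (n * 0 + t)
    first = ∑-cong n (λ t _ → cong (λ x → f (x + t)) (sym (*-zeroʳ n)))
    rest : ∑[ k < m * n ] f (n + k) ≡ ∑[ j < m ] ∑[ t < n ] f (n * suc j + t)
    rest = trans (∑-blocks m n (λ k → f (n + k)))
                 (∑-cong m (λ j _ → ∑-cong n (λ t _ → cong f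
                    (trans (sym (+-assoc n (n * j) t)) (cong (_+ t) (sym (*-suc n j)))))))

  #-none : ∀ n {g : ℕ → Bool} → (∀ k → k < n → g k ≡ false) → # n g ≡ 0
  #-none n g≗false = ∑-zeros n (λ k k<n → cong boolToℕ (g≗false k k<n))

  #-all : ∀ n {g : ℕ → Bool} → (∀ k → k < n → g k ≡ true) → # n g ≡ n
  #-all n g≗true = ∑-ones n (λ k k<n → cong boolToℕ (g≗true k k<n))

  #-unique : ∀ n {g : ℕ → Bool} w → w < n → g w ≡ true →
             (∀ k → k < n → g k ≡ true → k ≡ w) → # n g ≡ 1
  #-unique (suc n) {g} zero w<n gw unique with g 0
  ... | true  = cong suc (#-none n others)
    where
    others : ∀ k → k < n → g (suc k) ≡ false
    others k k<n with g (suc k) in gk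
    ... | true  = ⊥-elim (1+n≢0 (unique (suc k) (s<s k<n) gk))
    ... | false = refl
  #-unique (suc n) {g} (suc w) (s<s w<n) gw unique with g 0 in g0
  ... | true  = ⊥-elim (0≢1+n (unique 0 z<s g0))
  ... | false = #-unique n w w<n gw (λ k k<n gk → suc-injective (unique (suc k) (s<s k<n) gk))

  #-atMostOne : ∀ n (g : ℕ → Bool) →
                (∀ k k' → k < n → k' < n → g k ≡ true → g k' ≡ true → k ≡ k') → # n g ≤ 1
  #-atMostOne zero    g unique = z≤n
  #-atMostOne (suc n) g unique with g 0 in g0
  ... | true  = s≤s (≤-reflexive (#-none n others))
    where
    others : ∀ k → k < n → g (suc k) ≡ false
    others k k<n with g (suc k) in gk
    ... | true  = ⊥-elim (0≢1+n (unique 0 (suc k) z<s (s<s k<n) g0 gk))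
    ... | false = refl
  ... | false = #-atMostOne n (λ k → g (suc k))
                  (λ k k' k<n k'<n gk gk' → suc-injective (unique (suc k) (suc k') (s<s k<n) (s<s k'<n) gk gk'))

  #-witness : ∀ n (g : ℕ → Bool) → 1 ≤ # n g → Σ[ w ∈ ℕ ] w < n × g w ≡ true
  #-witness (suc n) g 1≤#g with g 0 in g0
  ... | true  = 0 , z<s , g0
  ... | false with #-witness n (λ k → g (suc k)) 1≤#g
  ... | w , w<n , gw = suc w , s<s w<n , gw

  ∑≤n : ∀ n (f : ℕ → ℕ) → (∀ k → k < n → f k ≤ 1) → ∑ n f ≤ n
  ∑≤n zero    f f≤1 = z≤n
  ∑≤n (suc n) f f≤1 =
    +-mono-≤ (f≤1 0 z<s) (∑≤n n (λ k → f (suc k)) (λ k k<n → f≤1 (suc k) (s<s k<n)))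

  ∑≡n⇒≡1 : ∀ n (f : ℕ → ℕ) → (∀ k → k < n → f k ≤ 1) → ∑ n f ≡ n → ∀ k → k < n → f k ≡ 1
  ∑≡n⇒≡1 (suc n) f f≤1 ∑f≡n = λ where
      zero    _         → f0≡1
      (suc k) (s<s k<n) → ∑≡n⇒≡1 n (λ k → f (suc k)) rest≤1 rest≡n k k<n
    where
    rest≤1 : ∀ k → k < n → f (suc k) ≤ 1
    rest≤1 k k<n = f≤1 (suc k) (s<s k<n)
    rest≤n : ∑[ k < n ] f (suc k) ≤ n
    rest≤n = ∑≤n n (λ k → f (suc k)) rest≤1
    f0≡1 : f 0 ≡ 1
    f0≡1 = ≤-antisym (f≤1 0 z<s)
             (+-cancelʳ-≤ n 1 (f 0) (≤-trans (≤-reflexive (sym ∑f≡n)) (+-monoʳ-≤ (f 0) rest≤n)))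
    rest≡n : ∑[ k < n ] f (suc k) ≡ n
    rest≡n = suc-injective (trans (cong (_+ ∑[ k < n ] f (suc k)) (sym f0≡1)) ∑f≡n)

  #-preimages : ∀ m n (v : ℕ → ℕ) → (∀ a → a < n → v a < m) → ∑[ x < m ] #[ a < n ] does (v a ≟ x) ≡ n
  #-preimages m n v v<m = trans (∑-comm m n (λ x a → boolToℕ (does (v a ≟ x)))) (∑-ones n image)
    where
    image : ∀ a → a < n → #[ x < m ] does (v a ≟ x) ≡ 1
    image a a<n = #-unique m (v a) (v<m a a<n) (dec-true (v a ≟ v a) refl)
                                (λ x _ va≡x → sym (does⇒ (v a ≟ x) va≡x))

  #-injective : ∀ n (ψ : ℕ → ℕ) → (∀ a → a < n → ψ a < n) →
                (∀ a a' → a < n → a' < n → ψ a ≡ ψ a' → a ≡ a') →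
                ∀ x → x < n → #[ a < n ] does (ψ a ≟ x) ≡ 1
  #-injective n ψ ψ<n injective = ∑≡n⇒≡1 n (λ x → #[ a < n ] does (ψ a ≟ x)) atMostOne (#-preimages n n ψ ψ<n)
    where
    atMostOne : ∀ x → x < n → #[ a < n ] does (ψ a ≟ x) ≤ 1
    atMostOne x _ = #-atMostOne n _ (λ a a' a<n a'<n ψa≡x ψa'≡x →
      injective a a' a<n a'<n (trans (does⇒ (ψ a ≟ x) ψa≡x) (sym (does⇒ (ψ a' ≟ x) ψa'≡x))))

  punchIn : ℕ → ℕ → ℕ
  punchIn a l = if does (a ≤? l) then suc l else l

  #-punchIn : ∀ n a (g : ℕ → Bool) → a ≤ n → #[ l < n ] g (punchIn a l) + boolToℕ (g a) ≡ # (suc n) g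
  #-punchIn n       zero    g _         = +-comm (#[ l < n ] g (suc l)) (boolToℕ (g 0))
  #-punchIn (suc n) (suc a) g (s≤s a≤n) = begin
    boolToℕ (g 0) + #[ l < n ] g (punchIn (suc a) (suc l)) + boolToℕ (g (suc a))
      ≡⟨ cong (λ x → boolToℕ (g 0) + x + boolToℕ (g (suc a))) (#-cong n (λ l _ → cong g (punchIn-suc a l))) ⟩
    boolToℕ (g 0) + #[ l < n ] g (suc (punchIn a l)) + boolToℕ (g (suc a))
      ≡⟨ +-assoc (boolToℕ (g 0)) _ _ ⟩
    boolToℕ (g 0) + (#[ l < n ] g (suc (punchIn a l)) + boolToℕ (g (suc a)))
      ≡⟨ cong (boolToℕ (g 0) +_) (#-punchIn n a (λ k → g (suc k)) a≤n) ⟩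
    boolToℕ (g 0) + # (suc n) (λ k → g (suc k))
      ∎
    where
    open ≡-Reasoning
    punchIn-suc : ∀ a l → punchIn (suc a) (suc l) ≡ suc (punchIn a l)
    punchIn-suc zero    l = refl
    punchIn-suc (suc a) l with does (suc a ≤? l)
    ... | true  = refl
    ... | false = refl

  #-single : ∀ n l (h : ℕ → Bool) → l < n → #[ a < n ] (does (a ≟ l) ∧ h a) ≡ boolToℕ (h l)
  #-single n l h l<n with h l in hl
  ... | true  = #-unique n l l<n (trans (cong (_∧ h l) (dec-true (l ≟ l) refl)) hl)
                  (λ a _ eq → does⇒ (a ≟ l) (∧-true eq))
    where
    ∧-true : ∀ {x y} → x ∧ y ≡ true → x ≡ true
    ∧-true {true} _ = refl
  ... | false = #-none n off
    where
    off : ∀ a → a < n → does (a ≟ l) ∧ h a ≡ false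
    off a _ with a ≟ l
    ... | yes refl = trans (cong (_∧ h a) (dec-true (a ≟ a) refl)) hl
    ... | no  a≢l  = cong (_∧ h a) (dec-false (a ≟ l) a≢l)

  boolToℕ-if : ∀ b x y → boolToℕ (if b then x else y) ≡ boolToℕ (b ∧ x) + boolToℕ (not b ∧ y)
  boolToℕ-if true  x y = sym (+-identityʳ (boolToℕ x))
  boolToℕ-if false x y = refl

  boolToℕ-≤-both : ∀ a l e →
                   boolToℕ (does (a ≤? l) ∧ e) + boolToℕ (does (l ≤? a) ∧ e) ≡ boolToℕ e + boolToℕ (does (a ≟ l) ∧ e)
  boolToℕ-≤-both a l e with <-cmp a l
  ... | tri< a<l a≢l _
    rewrite dec-true (a ≤? l) (<⇒≤ a<l) | dec-false (l ≤? a) (<⇒≱ a<l) | dec-false (a ≟ l) a≢l = refl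
  ... | tri≈ _ refl _
    rewrite dec-true (a ≤? a) ≤-refl | dec-true (a ≟ a) refl = refl
  ... | tri> _ a≢l l<a
    rewrite dec-false (a ≤? l) (<⇒≱ l<a) | dec-true (l ≤? a) (<⇒≤ l<a) | dec-false (a ≟ l) a≢l = +-comm 0 _

  -- The modulus is passed as p - 1, so that p is a successor and, for instance, 0 % p reduces to 0.
  module Modular (p-1 : ℕ) where

    p : ℕ
    p = suc p-1

    infix 4 _≈_ _≈?_

    record _≈_ (a b : ℕ) : Set where
      constructor mk≈
      field %-≡ : a % p ≡ b % p

    open _≈_ public

    _≈?_ : (a b : ℕ) → Dec (a ≈ b)
    a ≈? b = map′ mk≈ %-≡ (a % p ≟ b % p)

    ≈-refl : ∀ {a} → a ≈ a
    ≈-refl = mk≈ refl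

    ≈-sym : ∀ {a b} → a ≈ b → b ≈ a
    ≈-sym (mk≈ eq) = mk≈ (sym eq)

    ≈-trans : ∀ {a b c} → a ≈ b → b ≈ c → a ≈ c
    ≈-trans (mk≈ eq) (mk≈ eq') = mk≈ (trans eq eq')

    ≈-setoid : Setoid 0ℓ 0ℓ
    ≈-setoid = record { _≈_ = _≈_ ; isEquivalence = record { refl = ≈-refl ; sym = ≈-sym ; trans = ≈-trans } }

    module ≈-Reasoning = SetoidReasoning ≈-setoid

    ≈?-congˡ : ∀ {a b} X → a ≈ b → does (a ≈? X) ≡ does (b ≈? X)
    ≈?-congˡ X (mk≈ eq) = cong (_≡ᵇ X % p) eq

    ≈?-comm : ∀ a b → does (a ≈? b) ≡ does (b ≈? a)
    ≈?-comm a b = does-⇔ (mk⇔ ≈-sym ≈-sym) (a ≈? b) (b ≈? a)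

    +-cong : ∀ {a b c d} → a ≈ b → c ≈ d → a + c ≈ b + d
    +-cong {a} {b} {c} {d} (mk≈ a≈b) (mk≈ c≈d) = mk≈ (begin
      (a + c) % p            ≡⟨ %-distribˡ-+ a c p ⟩
      (a % p + c % p) % p    ≡⟨ cong₂ (λ x y → (x + y) % p) a≈b c≈d ⟩
      (b % p + d % p) % p    ≡⟨ %-distribˡ-+ b d p ⟨
      (b + d) % p            ∎)
      where open ≡-Reasoning

    *-cong : ∀ {a b c d} → a ≈ b → c ≈ d → a * c ≈ b * d
    *-cong {a} {b} {c} {d} (mk≈ a≈b) (mk≈ c≈d) = mk≈ (begin
      (a * c) % p            ≡⟨ %-distribˡ-* a c p ⟩
      (a % p * (c % p)) % p  ≡⟨ cong₂ (λ x y → (x * y) % p) a≈b c≈d ⟩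
      (b % p * (d % p)) % p  ≡⟨ %-distribˡ-* b d p ⟨
      (b * d) % p            ∎)
      where open ≡-Reasoning

    +-congˡ : ∀ a {b c} → b ≈ c → a + b ≈ a + c
    +-congˡ a = +-cong (≈-refl {a})

    +-congʳ : ∀ a {b c} → b ≈ c → b + a ≈ c + a
    +-congʳ a b≈c = +-cong b≈c (≈-refl {a})

    p*≈0 : ∀ m → p * m ≈ 0
    p*≈0 m = mk≈ (trans (cong (_% p) (*-comm p m)) (m*n%n≡0 m p))

    p≈0 : p ≈ 0
    p≈0 = mk≈ (n%n≡0 p)

    ≈⇒≡ : ∀ {a b} → a < p → b < p → a ≈ b → a ≡ b
    ≈⇒≡ a<p b<p (mk≈ eq) = trans (sym (m<n⇒m%n≡m a<p)) (trans eq (m<n⇒m%n≡m b<p))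

    positive≉0 : ∀ {e} → 0 < e → e < p → ¬ (e ≈ 0)
    positive≉0 0<e e<p e≈0 = <⇒≢ 0<e (sym (≈⇒≡ e<p z<s e≈0))

    +-inverseʳ : ∀ c → c + p-1 * c ≈ 0
    +-inverseʳ = p*≈0

    +-cancelʳ : ∀ {a b} c → a + c ≈ b + c → a ≈ b
    +-cancelʳ {a} {b} c a+c≈b+c = begin
      a                      ≡⟨ +-identityʳ a ⟨
      a + 0                  ≈⟨ +-congˡ a (+-inverseʳ c) ⟨
      a + (c + p-1 * c)      ≡⟨ +-assoc a c _ ⟨
      a + c + p-1 * c        ≈⟨ +-congʳ (p-1 * c) a+c≈b+c ⟩
      b + c + p-1 * c        ≡⟨ +-assoc b c _ ⟩
      b + (c + p-1 * c)      ≈⟨ +-congˡ b (+-inverseʳ c) ⟩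
      b + 0                  ≡⟨ +-identityʳ b ⟩
      b                      ∎
      where open ≈-Reasoning

    +-cancelˡ : ∀ {a b} c → c + a ≈ c + b → a ≈ b
    +-cancelˡ {a} {b} c c+a≈c+b = +-cancelʳ c (begin
      a + c  ≡⟨ +-comm a c ⟩
      c + a  ≈⟨ c+a≈c+b ⟩
      c + b  ≡⟨ +-comm c b ⟩
      b + c  ∎)
      where open ≈-Reasoning

    p∸m≈m*[p-1] : ∀ {m} → m ≤ p → p ∸ m ≈ m * p-1
    p∸m≈m*[p-1] {m} m≤p = +-cancelʳ m (begin
      p ∸ m + m        ≡⟨ m∸n+n≡m m≤p ⟩
      p                ≈⟨ p≈0 ⟩
      0                ≈⟨ p*≈0 m ⟨
      p * m            ≡⟨ *-comm p m ⟩
      m * p            ≡⟨ *-suc m p-1 ⟩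
      m + m * p-1      ≡⟨ +-comm m _ ⟩
      m * p-1 + m      ∎)
      where open ≈-Reasoning

    ≈⇔+[p-1]*≈0 : ∀ x y → (x ≈ y) ⇔ (x + p-1 * y ≈ 0)
    ≈⇔+[p-1]*≈0 x y = mk⇔ (λ x≈y → ≈-trans (+-congʳ (p-1 * y) x≈y) (+-inverseʳ y))
                          (λ x-y≈0 → +-cancelʳ (p-1 * y) (≈-trans x-y≈0 (≈-sym (+-inverseʳ y))))

    #-≈-injective : (ψ : ℕ → ℕ) → (∀ a a' → a < p → a' < p → ψ a ≈ ψ a' → a ≡ a') →
                    ∀ X → #[ a < p ] does (ψ a ≈? X) ≡ 1
    #-≈-injective ψ injective X =
      #-injective p (λ a → ψ a % p) (λ a _ → m%n<n (ψ a) p)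
                  (λ a a' a<p a'<p eq → injective a a' a<p a'<p (mk≈ eq)) (X % p) (m%n<n X p)

    #-shift : ∀ K X → #[ t < p ] does (K + t ≈? X) ≡ 1
    #-shift K = #-≈-injective (K +_) (λ t t' t<p t'<p K+t≈K+t' → ≈⇒≡ t<p t'<p (+-cancelˡ K K+t≈K+t'))

    #-values : ∀ X → #[ a < p ] does (X ≈? a) ≡ 1
    #-values X = trans (#-cong p (λ a _ → ≈?-comm X a)) (#-shift 0 X)

    #-common-value : ∀ U V → #[ a < p ] (does (U ≈? a) ∧ does (V ≈? a)) ≡ boolToℕ (does (U ≈? V))
    #-common-value U V with U ≈? V
    ... | yes U≈V = begin
      #[ a < p ] (does (U ≈? a) ∧ does (V ≈? a))   ≡⟨ #-cong p (λ a _ → cong (_∧ does (V ≈? a)) (≈?-congˡ a U≈V)) ⟩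
      #[ a < p ] (does (V ≈? a) ∧ does (V ≈? a))   ≡⟨ #-cong p (λ a _ → ∧-idem (does (V ≈? a))) ⟩
      #[ a < p ] does (V ≈? a)                     ≡⟨ #-values V ⟩
      1                                            ≡⟨ cong boolToℕ (dec-true (U ≈? V) U≈V) ⟨
      boolToℕ (does (U ≈? V))                      ∎
      where open ≡-Reasoning
    ... | no  U≉V = trans (#-none p neither) (cong boolToℕ (sym (dec-false (U ≈? V) U≉V)))
      where
      neither : ∀ a → a < p → does (U ≈? a) ∧ does (V ≈? a) ≡ false
      neither a _ with does (U ≈? a) in U≈a | does (V ≈? a) in V≈a
      ... | true  | true  = ⊥-elim (U≉V (≈-trans (does⇒ (U ≈? a) U≈a) (≈-sym (does⇒ (V ≈? a) V≈a))))
      ... | true  | false = refl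
      ... | false | _     = refl

    partners≤ partners> : ℕ → ℕ → ℕ
    partners≤ v l = #[ a < p ] (does (a ≤? l) ∧ does (a + l ≈? v))
    partners> v l = #[ a < p ] (not (does (a ≤? l)) ∧ does (a + l ≈? v))

    #-partners : ∀ v l → #[ a < p ] does (a + l ≈? v) ≡ 1
    #-partners v l = trans (#-cong p (λ a _ → cong (λ x → does (x ≈? v)) (+-comm a l))) (#-shift l v)

    partners≤+partners> : ∀ v l → partners≤ v l + partners> v l ≡ 1
    partners≤+partners> v l = begin
      partners≤ v l + partners> v l
        ≡⟨ ∑-distrib-+ p (λ a → boolToℕ (≤l a ∧ hit a)) (λ a → boolToℕ (not (≤l a) ∧ hit a)) ⟨
      ∑[ a < p ] (boolToℕ (≤l a ∧ hit a) + boolToℕ (not (≤l a) ∧ hit a))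
        ≡⟨ ∑-cong p (λ a _ → boolToℕ-if (≤l a) (hit a) (hit a)) ⟨
      #[ a < p ] (if ≤l a then hit a else hit a)
        ≡⟨ #-cong p (λ a _ → if-same {hit a} (≤l a)) ⟩
      #[ a < p ] does (a + l ≈? v)
        ≡⟨ #-partners v l ⟩
      1 ∎
      where
      open ≡-Reasoning
      ≤l hit : ℕ → Bool
      ≤l a  = does (a ≤? l)
      hit a = does (a + l ≈? v)
      if-same : ∀ {x} b → (if b then x else x) ≡ x
      if-same true  = refl
      if-same false = refl

    module _ (prime : Prime p) where

      *-cancelʳ : ∀ {a b} c → ¬ (c ≈ 0) → a * c ≈ b * c → a ≈ b
      *-cancelʳ {a} {b} c c≉0 ac≈bc =
        [ (λ a≤b → cancel a≤b ac≈bc) , (λ b≤a → ≈-sym (cancel b≤a (≈-sym ac≈bc))) ]′ (≤-total a b)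
        where
        cancel : ∀ {a b} → a ≤ b → a * c ≈ b * c → a ≈ b
        cancel {a} {b} a≤b ac≈bc with euclidsLemma (b ∸ a) c prime (m%n≡0⇒n∣m _ p (sym (%-≡ [b-a]c≈0)))
          where
          [b-a]c≈0 : 0 ≈ (b ∸ a) * c
          [b-a]c≈0 = +-cancelˡ (a * c) (begin
            a * c + 0              ≡⟨ +-identityʳ (a * c) ⟩
            a * c                  ≈⟨ ac≈bc ⟩
            b * c                  ≡⟨ cong (_* c) (m+[n∸m]≡n a≤b) ⟨
            (a + (b ∸ a)) * c      ≡⟨ *-distribʳ-+ c a (b ∸ a) ⟩
            a * c + (b ∸ a) * c    ∎)
            where open ≈-Reasoning
        ... | inj₂ p∣c   = ⊥-elim (c≉0 (mk≈ (n∣m⇒m%n≡0 c p p∣c)))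
        ... | inj₁ p∣b-a = begin
            a              ≡⟨ +-identityʳ a ⟨
            a + 0          ≈⟨ +-congˡ a (mk≈ (n∣m⇒m%n≡0 (b ∸ a) p p∣b-a)) ⟨
            a + (b ∸ a)    ≡⟨ m+[n∸m]≡n a≤b ⟩
            b              ∎
            where open ≈-Reasoning

      #-affine : ∀ {e} → ¬ (e ≈ 0) → ∀ K X → #[ a < p ] does (a * e + K ≈? X) ≡ 1
      #-affine {e} e≉0 K = #-≈-injective (λ a → a * e + K)
        (λ a a' a<p a'<p eq → ≈⇒≡ a<p a'<p (*-cancelʳ e e≉0 (+-cancelʳ K eq)))

      #-affine-agree : ∀ {b b'} → ¬ (b ≈ b') → ∀ K K' → #[ a < p ] does (a * b + K ≈? a * b' + K') ≡ 1
      #-affine-agree {b} {b'} b≉b' K K' =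
        trans (#-cong p (λ a _ → does-⇔ (difference a) (a * b + K ≈? a * b' + K') (a * B + K″ ≈? 0)))
              (#-affine (λ eq → b≉b' (Equivalence.from (≈⇔+[p-1]*≈0 b b') eq)) K″ 0)
        where
        regroup : ∀ a b b' K K' m → a * b + K + m * (a * b' + K') ≡ a * (b + m * b') + (K + m * K')
        regroup = solve-∀
        B K″ : ℕ
        B  = b + p-1 * b'
        K″ = K + p-1 * K'
        difference : ∀ a → (a * b + K ≈ a * b' + K') ⇔ (a * B + K″ ≈ 0)
        difference a = subst (λ z → (a * b + K ≈ a * b' + K') ⇔ (z ≈ 0)) (regroup a b b' K K' p-1) (≈⇔+[p-1]*≈0 _ _)

      -- Over all l < p, the pairs a ≤ l and the pairs l ≤ a are equinumerous and overlap on the diagonal a = l,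
      -- which meets each residue once as 2 is invertible; the term l = p - 1 contributes one pair.
      ∑partners≤-independent : 2 < p → ∀ v v' → ∑[ l < p-1 ] partners≤ v l ≡ ∑[ l < p-1 ] partners≤ v' l
      ∑partners≤-independent 2<p v v' =
        +-cancelʳ-≡ 1 _ _ (*-cancelˡ-≡ _ _ 2 (trans (two*below v) (sym (two*below v'))))
        where
        hit : ℕ → ℕ → ℕ → Bool
        hit v a l = does (a + l ≈? v)

        below above diagonal : ℕ → ℕ
        below    v = ∑[ l < p ] partners≤ v l
        above    v = ∑[ l < p ] #[ a < p ] (does (l ≤? a) ∧ hit v a l)
        diagonal v = ∑[ l < p ] #[ a < p ] (does (a ≟ l) ∧ hit v a l)

        below-last : ∀ v → below v ≡ ∑[ l < p-1 ] partners≤ v l + 1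
        below-last v = trans (∑-init-last p-1 (partners≤ v)) (cong (∑[ l < p-1 ] partners≤ v l +_) (begin
          partners≤ v p-1
            ≡⟨ #-cong p (λ a a<p → cong (_∧ hit v a p-1) (dec-true (a ≤? p-1) (≤-pred a<p))) ⟩
          #[ a < p ] does (a + p-1 ≈? v)
            ≡⟨ #-partners v p-1 ⟩
          1 ∎))
          where open ≡-Reasoning

        above≡below : ∀ v → above v ≡ below v
        above≡below v = trans (∑-comm p p (λ l a → boolToℕ (does (l ≤? a) ∧ hit v a l)))
                              (∑-cong p (λ l _ → ∑-cong p (λ a _ →
                                 cong (λ x → boolToℕ (does (a ≤? l) ∧ does (x ≈? v))) (+-comm l a))))

        diagonal≡1 : ∀ v → diagonal v ≡ 1
        diagonal≡1 v = begin
          diagonal v                        ≡⟨ ∑-cong p (λ l l<p → #-single p l (λ a → hit v a l) l<p) ⟩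
          #[ l < p ] does (l + l ≈? v)      ≡⟨ #-cong p (λ l _ → cong (λ x → does (x ≈? v)) (l+l≡l*2+0 l)) ⟩
          #[ l < p ] does (l * 2 + 0 ≈? v)  ≡⟨ #-affine (positive≉0 z<s 2<p) 0 v ⟩
          1                                 ∎
          where
          open ≡-Reasoning
          l+l≡l*2+0 : ∀ l → l + l ≡ l * 2 + 0
          l+l≡l*2+0 = solve-∀

        below+above : ∀ v → below v + above v ≡ p + diagonal v
        below+above v = begin
          below v + above v
            ≡⟨ ∑-distrib-+ p (partners≤ v) (λ l → #[ a < p ] (does (l ≤? a) ∧ hit v a l)) ⟨
          ∑[ l < p ] (partners≤ v l + #[ a < p ] (does (l ≤? a) ∧ hit v a l))
            ≡⟨ ∑-cong p (λ l _ → line l) ⟩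
          ∑[ l < p ] (#[ a < p ] hit v a l + #[ a < p ] (does (a ≟ l) ∧ hit v a l))
            ≡⟨ ∑-distrib-+ p (λ l → #[ a < p ] hit v a l) (λ l → #[ a < p ] (does (a ≟ l) ∧ hit v a l)) ⟩
          ∑[ l < p ] #[ a < p ] hit v a l + diagonal v
            ≡⟨ cong (_+ diagonal v) (∑-ones p (λ l _ → #-partners v l)) ⟩
          p + diagonal v
            ∎
          where
          open ≡-Reasoning
          line : ∀ l → partners≤ v l + #[ a < p ] (does (l ≤? a) ∧ hit v a l)
                     ≡ #[ a < p ] hit v a l + #[ a < p ] (does (a ≟ l) ∧ hit v a l)
          line l = begin
            partners≤ v l + #[ a < p ] (does (l ≤? a) ∧ hit v a l)
              ≡⟨ ∑-distrib-+ p (λ a → boolToℕ (does (a ≤? l) ∧ hit v a l))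
                               (λ a → boolToℕ (does (l ≤? a) ∧ hit v a l)) ⟨
            ∑[ a < p ] (boolToℕ (does (a ≤? l) ∧ hit v a l) + boolToℕ (does (l ≤? a) ∧ hit v a l))
              ≡⟨ ∑-cong p (λ a _ → boolToℕ-≤-both a l (hit v a l)) ⟩
            ∑[ a < p ] (boolToℕ (hit v a l) + boolToℕ (does (a ≟ l) ∧ hit v a l))
              ≡⟨ ∑-distrib-+ p (λ a → boolToℕ (hit v a l)) (λ a → boolToℕ (does (a ≟ l) ∧ hit v a l)) ⟩
            #[ a < p ] hit v a l + #[ a < p ] (does (a ≟ l) ∧ hit v a l)
              ∎

        two*below : ∀ v → 2 * (∑[ l < p-1 ] partners≤ v l + 1) ≡ p + 1
        two*below v = begin
          2 * (∑[ l < p-1 ] partners≤ v l + 1)  ≡⟨ cong (2 *_) (below-last v) ⟨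
          below v + (below v + 0)               ≡⟨ cong (below v +_) (trans (+-identityʳ _) (sym (above≡below v))) ⟩
          below v + above v                     ≡⟨ below+above v ⟩
          p + diagonal v                        ≡⟨ cong (p +_) (diagonal≡1 v) ⟩
          p + 1                                 ∎
          where open ≡-Reasoning

  [n*j+t]%n≡t : ∀ n .{{_ : NonZero n}} j {t} → t < n → (n * j + t) % n ≡ t
  [n*j+t]%n≡t n j {t} t<n = begin
    (n * j + t) % n   ≡⟨ cong (_% n) (trans (+-comm (n * j) t) (cong (t +_) (*-comm n j))) ⟩
    (t + j * n) % n   ≡⟨ [m+kn]%n≡m%n t j n ⟩
    t % n             ≡⟨ m<n⇒m%n≡m t<n ⟩
    t                 ∎
    where open ≡-Reasoning

  [n*j+t]/n≡j : ∀ n .{{_ : NonZero n}} j {t} → t < n → (n * j + t) / n ≡ j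
  [n*j+t]/n≡j n j {t} t<n = begin
    (n * j + t) / n       ≡⟨ +-distrib-/-∣ˡ t (divides j (*-comm n j)) ⟩
    n * j / n + t / n     ≡⟨ cong₂ _+_ (trans (cong (_/ n) (*-comm n j)) (m*n/n≡m j n)) (m<n⇒m/n≡0 t<n) ⟩
    j + 0                 ≡⟨ +-identityʳ j ⟩
    j                     ∎
    where open ≡-Reasoning

  module Entries (q : ℕ) where

    open Modular (suc (suc q)) using (p)

    p-1 : ℕ
    p-1 = suc (suc q)

    raw : ℕ → ℕ → ℕ
    raw = rawEntry p

    hRow : ℕ → ℕ → ℕ
    hRow a l = p + (p-1 * a + l)

    raw-H* : ∀ {r} j {t} → r < p → t < p → raw r (p * j + t) ≡ r + j
    raw-H* {r} j r<p t<p rewrite dec-true (r <? p) r<p | [n*j+t]/n≡j p j t<p = refl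

    raw-shift : ∀ {r} j {t} → p ≤ r → t < p → raw r (p * j + t) ≡ raw r (p * j) + t
    raw-shift {r} j {t} p≤r t<p
      rewrite dec-false (r <? p) (≤⇒≯ p≤r) | [n*j+t]/n≡j p j t<p | [n*j+t]%n≡t p j t<p
            | sym (+-identityʳ (p * j)) | [n*j+t]/n≡j p j {0} z<s | [n*j+t]%n≡t p j {0} z<s
      with does (j <? p-1) | does ((r ∸ p) / p-1 ≤? (r ∸ p) % p-1)
    ... | true  | _     = cong (_+ t) (sym (+-identityʳ _))
    ... | false | true  = cong (_+ t) (sym (+-identityʳ _))
    ... | false | false = cong (_+ t) (sym (+-identityʳ _))

    raw-H : ∀ a {l} j {t} → l < p-1 → j < p-1 → t < p → raw (hRow a l) (p * j + t) ≡ a * (j + 1) + j * l + t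
    raw-H a {l} j {t} l<p-1 j<p-1 t<p
      rewrite dec-false (hRow a l <? p) (≤⇒≯ (m≤m+n p _)) | m+n∸m≡n p (p-1 * a + l)
            | [n*j+t]/n≡j p-1 a l<p-1 | [n*j+t]%n≡t p-1 a l<p-1
            | [n*j+t]/n≡j p j t<p | [n*j+t]%n≡t p j t<p | dec-true (j <? p-1) j<p-1 = refl

    raw-last : ∀ a {l t} → l < p-1 → t < p →
               raw (hRow a l) (p * p-1 + t) ≡ p ∸ l + (if does (a ≤? l) then t else suc t)
    raw-last a {l} {t} l<p-1 t<p
      rewrite dec-false (hRow a l <? p) (≤⇒≯ (m≤m+n p _)) | m+n∸m≡n p (p-1 * a + l)
            | [n*j+t]/n≡j p-1 a l<p-1 | [n*j+t]%n≡t p-1 a l<p-1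
            | [n*j+t]/n≡j p p-1 t<p | [n*j+t]%n≡t p p-1 t<p | dec-false (p-1 <? p-1) (<-irrefl refl)
      with does (a ≤? l)
    ... | true  = refl
    ... | false = +-assoc (p ∸ l) 1 t

    raw-last-punchIn : ∀ a {l t} → l < p-1 → t < p → raw (hRow a l) (p * p-1 + t) ≡ p ∸ punchIn a l + suc t
    raw-last-punchIn a {l} {t} l<p-1 t<p rewrite raw-last a l<p-1 t<p with does (a ≤? l)
    ... | true  = begin
      p ∸ l + t                ≡⟨ cong (_+ t) (+-∸-assoc 1 (s≤s (<⇒≤ l<p-1))) ⟩
      suc (p ∸ suc l) + t      ≡⟨ +-suc (p ∸ suc l) t ⟨
      p ∸ suc l + suc t        ∎
      where open ≡-Reasoning
    ... | false = refl

  module Properties (q : ℕ) (prime : Prime (suc (suc (suc q)))) where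

    open Modular (suc (suc q))
    open Entries q

    agree : ℕ → ℕ → ℕ → Bool
    agree c c' r = does (raw r c ≈? raw r c')

    #-rows : ∀ g → # (p * p) g ≡ # p g + ∑[ a < p ] #[ l < p-1 ] g (hRow a l)
    #-rows g = begin
      # (p + p-1 * p) g                             ≡⟨ ∑-++ p (p-1 * p) (λ r → boolToℕ (g r)) ⟩
      # p g + #[ k < p-1 * p ] g (p + k)            ≡⟨ cong (λ n → # p g + #[ k < n ] g (p + k)) (*-comm p-1 p) ⟩
      # p g + #[ k < p * p-1 ] g (p + k)            ≡⟨ cong (# p g +_) (∑-blocks p p-1 (λ k → boolToℕ (g (p + k)))) ⟩
      # p g + ∑[ a < p ] #[ l < p-1 ] g (hRow a l)  ∎
      where open ≡-Reasoning

    row-count : ∀ r X → #[ c < p * p ] does (raw r c ≈? X) ≡ p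
    row-count r X with r <? p
    ... | yes r<p = begin
      #[ c < p * p ] does (raw r c ≈? X)
        ≡⟨ ∑-blocks p p (λ c → boolToℕ (does (raw r c ≈? X))) ⟩
      ∑[ j < p ] #[ t < p ] does (raw r (p * j + t) ≈? X)
        ≡⟨ ∑-cong p (λ j _ → #-cong p (λ t t<p → cong (λ x → does (x ≈? X)) (raw-H* j r<p t<p))) ⟩
      ∑[ j < p ] #[ t < p ] does (r + j ≈? X)
        ≡⟨ ∑-comm p p (λ j t → boolToℕ (does (r + j ≈? X))) ⟩
      ∑[ t < p ] #[ j < p ] does (r + j ≈? X)
        ≡⟨ ∑-ones p (λ _ _ → #-shift r X) ⟩
      p ∎
      where open ≡-Reasoning
    ... | no r≮p = begin
      #[ c < p * p ] does (raw r c ≈? X)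
        ≡⟨ ∑-blocks p p (λ c → boolToℕ (does (raw r c ≈? X))) ⟩
      ∑[ j < p ] #[ t < p ] does (raw r (p * j + t) ≈? X)
        ≡⟨ ∑-cong p (λ j _ → #-cong p (λ t t<p → cong (λ x → does (x ≈? X)) (raw-shift j (≮⇒≥ r≮p) t<p))) ⟩
      ∑[ j < p ] #[ t < p ] does (raw r (p * j) + t ≈? X)
        ≡⟨ ∑-ones p (λ j _ → #-shift (raw r (p * j)) X) ⟩
      p ∎
      where open ≡-Reasoning

    j+1≉0 : ∀ {j} → j < p-1 → ¬ (j + 1 ≈ 0)
    j+1≉0 {j} j<p-1 = positive≉0 (m≤n+m 1 j) (subst (_< p) (+-comm 1 j) (s≤s j<p-1))

    column-count-H* : ∀ j {t} X → t < p → #[ r < p ] does (raw r (p * j + t) ≈? X) ≡ 1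
    column-count-H* j X t<p = trans (#-cong p (λ r r<p → cong (λ x → does (x ≈? X)) (raw-H* j r<p t<p))) (#-partners X j)

    column-count-H : ∀ {j t} X → j < p-1 → t < p → ∑[ a < p ] #[ l < p-1 ] does (raw (hRow a l) (p * j + t) ≈? X) ≡ p-1
    column-count-H {j} {t} X j<p-1 t<p = begin
      ∑[ a < p ] #[ l < p-1 ] does (raw (hRow a l) (p * j + t) ≈? X)
        ≡⟨ ∑-cong p (λ a _ → #-cong p-1 (λ l l<p-1 → cong (λ x → does (x ≈? X)) (entry a l<p-1))) ⟩
      ∑[ a < p ] #[ l < p-1 ] does (a * (j + 1) + (j * l + t) ≈? X)
        ≡⟨ ∑-comm p p-1 (λ a l → boolToℕ (does (a * (j + 1) + (j * l + t) ≈? X))) ⟩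
      ∑[ l < p-1 ] #[ a < p ] does (a * (j + 1) + (j * l + t) ≈? X)
        ≡⟨ ∑-ones p-1 (λ l _ → #-affine prime (j+1≉0 j<p-1) (j * l + t) X) ⟩
      p-1 ∎
      where
      open ≡-Reasoning
      entry : ∀ a {l} → l < p-1 → raw (hRow a l) (p * j + t) ≡ a * (j + 1) + (j * l + t)
      entry a l<p-1 = trans (raw-H a j l<p-1 j<p-1 t<p) (+-assoc (a * (j + 1)) _ t)

    -- In H_a the last block of columns takes every value but one, and each value is missed by exactly one a.
    column-count-last : ∀ {t} X → t < p → ∑[ a < p ] #[ l < p-1 ] does (raw (hRow a l) (p * p-1 + t) ≈? X) ≡ p-1
    column-count-last {t} X t<p = +-cancelʳ-≡ 1 _ _ (begin
      ∑[ a < p ] #[ l < p-1 ] does (raw (hRow a l) (p * p-1 + t) ≈? X) + 1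
        ≡⟨ cong₂ _+_ (∑-cong p (λ a _ → #-cong p-1 (λ l l<p-1 →
                       cong (λ x → does (x ≈? X)) (raw-last-punchIn a l<p-1 t<p))))
                     (sym #f≡1) ⟩
      ∑[ a < p ] #[ l < p-1 ] f (punchIn a l) + # p f
        ≡⟨ ∑-distrib-+ p (λ a → #[ l < p-1 ] f (punchIn a l)) (λ a → boolToℕ (f a)) ⟨
      ∑[ a < p ] (#[ l < p-1 ] f (punchIn a l) + boolToℕ (f a))
        ≡⟨ ∑-ones p (λ a a<p → trans (#-punchIn p-1 a f (≤-pred a<p)) #f≡1) ⟩
      p         ≡⟨ +-comm 1 p-1 ⟩
      p-1 + 1   ∎)
      where
      open ≡-Reasoning
      f : ℕ → Bool
      f m = does (p ∸ m + suc t ≈? X)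
      #f≡1 : # p f ≡ 1
      #f≡1 = trans (#-cong p (λ m m<p → ≈?-congˡ X (+-congʳ (suc t) (p∸m≈m*[p-1] (<⇒≤ m<p)))))
                   (#-affine prime (positive≉0 z<s ≤-refl) (suc t) X)

    ≮p-1⇒≡p-1 : ∀ {j} → j < p → ¬ (j < p-1) → j ≡ p-1
    ≮p-1⇒≡p-1 j<p j≮p-1 = ≤-antisym (≤-pred j<p) (≮⇒≥ j≮p-1)

    column-count : ∀ {j t} X → j < p → t < p → #[ r < p * p ] does (raw r (p * j + t) ≈? X) ≡ p
    column-count {j} {t} X j<p t<p =
      trans (#-rows (λ r → does (raw r (p * j + t) ≈? X))) (cong₂ _+_ (column-count-H* j X t<p) H-rows)
      where
      H-rows : ∑[ a < p ] #[ l < p-1 ] does (raw (hRow a l) (p * j + t) ≈? X) ≡ p-1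
      H-rows with j <? p-1
      ... | yes j<p-1 = column-count-H X j<p-1 t<p
      ... | no  j≮p-1 rewrite ≮p-1⇒≡p-1 j<p j≮p-1 = column-count-last X t<p

    same-block-agreement : ∀ i {t t'} → t < p → t' < p → t ≢ t' → #[ r < p * p ] agree (p * i + t) (p * i + t') r ≡ p
    same-block-agreement i {t} {t'} t<p t'<p t≢t' = begin
      #[ r < p * p ] agree (p * i + t) (p * i + t') r
        ≡⟨ #-rows (agree (p * i + t) (p * i + t')) ⟩
      #[ r < p ] agree (p * i + t) (p * i + t') r + ∑[ a < p ] #[ l < p-1 ] agree (p * i + t) (p * i + t') (hRow a l)
        ≡⟨ cong₂ _+_ (#-all p H*-agree) (∑-zeros p (λ a _ → #-none p-1 (λ l _ → H-disagree (hRow a l) (m≤m+n p _)))) ⟩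
      p + 0
        ≡⟨ +-identityʳ p ⟩
      p ∎
      where
      open ≡-Reasoning
      H*-agree : ∀ r → r < p → agree (p * i + t) (p * i + t') r ≡ true
      H*-agree r r<p rewrite raw-H* i r<p t<p | raw-H* i r<p t'<p = dec-true (r + i ≈? r + i) ≈-refl
      H-disagree : ∀ r → p ≤ r → agree (p * i + t) (p * i + t') r ≡ false
      H-disagree r p≤r rewrite raw-shift i p≤r t<p | raw-shift i p≤r t'<p =
        dec-false (_ ≈? _) (λ eq → t≢t' (≈⇒≡ t<p t'<p (+-cancelˡ (raw r (p * i)) eq)))

    module LastBlock {i t t'} (i<p-1 : i < p-1) (t<p : t < p) (t'<p : t' < p) where

      agree-last : ℕ → ℕ → Bool
      agree-last a l = agree (p * i + t) (p * p-1 + t') (hRow a l)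

      solution : ∀ c → Σ[ v ∈ ℕ ] v * (i + 1) + t ≈ c
      solution c = witness (#-witness p (λ v → does (v * (i + 1) + t ≈? c))
                                     (≤-reflexive (sym (#-affine prime (j+1≉0 i<p-1) t c))))
        where
        witness : Σ[ v ∈ ℕ ] v < p × does (v * (i + 1) + t ≈? c) ≡ true → Σ[ v ∈ ℕ ] v * (i + 1) + t ≈ c
        witness (v , _ , sol) = v , does⇒ (v * (i + 1) + t ≈? c) sol

      -- adding l to both sides turns the condition into (a + l) (i + 1) + t ≈ c
      agree⇔ : ∀ a {l c v} → l < p → v * (i + 1) + t ≈ c →
               (a * (i + 1) + i * l + t ≈ p ∸ l + c) ⇔ (a + l ≈ v)
      agree⇔ a {l} {c} {v} l<p v-sol = mk⇔
        (λ eq → *-cancelʳ prime (i + 1) (j+1≉0 i<p-1) (+-cancelʳ t (begin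
          (a + l) * (i + 1) + t            ≡⟨ regroup a i l t ⟨
          a * (i + 1) + i * l + t + l      ≈⟨ +-congʳ l eq ⟩
          p ∸ l + c + l                    ≈⟨ p∸l+c+l≈c ⟩
          c                                ≈⟨ v-sol ⟨
          v * (i + 1) + t                  ∎)))
        (λ a+l≈v → +-cancelʳ l (begin
          a * (i + 1) + i * l + t + l      ≡⟨ regroup a i l t ⟩
          (a + l) * (i + 1) + t            ≈⟨ +-congʳ t (*-cong a+l≈v ≈-refl) ⟩
          v * (i + 1) + t                  ≈⟨ v-sol ⟩
          c                                ≈⟨ p∸l+c+l≈c ⟨
          p ∸ l + c + l                    ∎))
        where
        open ≈-Reasoning
        regroup : ∀ a i l t → a * (i + 1) + i * l + t + l ≡ (a + l) * (i + 1) + t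
        regroup = solve-∀
        p∸l+c+l≈c : p ∸ l + c + l ≈ c
        p∸l+c+l≈c = begin
          p ∸ l + c + l    ≡⟨ +-assoc (p ∸ l) c l ⟩
          p ∸ l + (c + l)  ≡⟨ cong (p ∸ l +_) (+-comm c l) ⟩
          p ∸ l + (l + c)  ≡⟨ +-assoc (p ∸ l) l c ⟨
          p ∸ l + l + c    ≡⟨ cong (_+ c) (m∸n+n≡m (<⇒≤ l<p)) ⟩
          p + c            ≈⟨ +-congʳ c p≈0 ⟩
          c                ∎

      agree≡ : ∀ a {l w w'} → l < p-1 → w * (i + 1) + t ≈ t' → w' * (i + 1) + t ≈ suc t' →
               agree-last a l ≡ (if does (a ≤? l) then does (a + l ≈? w) else does (a + l ≈? w'))
      agree≡ a {l} {w} {w'} l<p-1 w-sol w'-sol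
        rewrite raw-H a i l<p-1 i<p-1 t<p | raw-last a l<p-1 t'<p with does (a ≤? l)
      ... | true  = does-⇔ (agree⇔ a {v = w} (<-trans l<p-1 ≤-refl) w-sol) (_ ≈? _) (_ ≈? _)
      ... | false = does-⇔ (agree⇔ a {v = w'} (<-trans l<p-1 ≤-refl) w'-sol) (_ ≈? _) (_ ≈? _)

      agreement-count : ∀ {w w'} → w * (i + 1) + t ≈ t' → w' * (i + 1) + t ≈ suc t' →
                        ∑[ a < p ] #[ l < p-1 ] agree-last a l ≡ p-1
      agreement-count {w} {w'} w-sol w'-sol = begin
        ∑[ a < p ] #[ l < p-1 ] agree-last a l
          ≡⟨ ∑-comm p p-1 (λ a l → boolToℕ (agree-last a l)) ⟩
        ∑[ l < p-1 ] #[ a < p ] agree-last a l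
          ≡⟨ ∑-cong p-1 (λ l l<p-1 → line l<p-1) ⟩
        ∑[ l < p-1 ] (partners≤ w l + partners> w' l)
          ≡⟨ ∑-distrib-+ p-1 (partners≤ w) (partners> w') ⟩
        ∑[ l < p-1 ] partners≤ w l + ∑[ l < p-1 ] partners> w' l
          ≡⟨ cong (_+ ∑[ l < p-1 ] partners> w' l) (∑partners≤-independent prime (s≤s (s≤s (s≤s z≤n))) w w') ⟩
        ∑[ l < p-1 ] partners≤ w' l + ∑[ l < p-1 ] partners> w' l
          ≡⟨ ∑-distrib-+ p-1 (partners≤ w') (partners> w') ⟨
        ∑[ l < p-1 ] (partners≤ w' l + partners> w' l)
          ≡⟨ ∑-ones p-1 (λ l _ → partners≤+partners> w' l) ⟩
        p-1 ∎
        where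
        open ≡-Reasoning
        line : ∀ {l} → l < p-1 → #[ a < p ] agree-last a l ≡ partners≤ w l + partners> w' l
        line {l} l<p-1 = begin
          #[ a < p ] agree-last a l
            ≡⟨ ∑-cong p (λ a _ → trans (cong boolToℕ (agree≡ a {w = w} {w' = w'} l<p-1 w-sol w'-sol))
                                       (boolToℕ-if (≤l a) (hit w a) (hit w' a))) ⟩
          ∑[ a < p ] (boolToℕ (≤l a ∧ hit w a) + boolToℕ (not (≤l a) ∧ hit w' a))
            ≡⟨ ∑-distrib-+ p (λ a → boolToℕ (≤l a ∧ hit w a)) (λ a → boolToℕ (not (≤l a) ∧ hit w' a)) ⟩
          partners≤ w l + partners> w' l ∎
          where
          ≤l : ℕ → Bool
          ≤l a = does (a ≤? l)
          hit : ℕ → ℕ → Bool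
          hit v a = does (a + l ≈? v)

      last-block-agreement : ∑[ a < p ] #[ l < p-1 ] agree-last a l ≡ p-1
      last-block-agreement =
        agreement-count {proj₁ (solution t')} {proj₁ (solution (suc t'))}
                        (proj₂ (solution t')) (proj₂ (solution (suc t')))

    cross-block-agreement : ∀ {i j t t'} → i < j → j < p → t < p → t' < p →
                            #[ r < p * p ] agree (p * i + t) (p * j + t') r ≡ p-1
    cross-block-agreement {i} {j} {t} {t'} i<j j<p t<p t'<p =
      trans (#-rows (agree (p * i + t) (p * j + t'))) (cong₂ _+_ (#-none p H*-disagree) H-rows)
      where
      i<p : i < p
      i<p = <-trans i<j j<p
      H*-disagree : ∀ r → r < p → agree (p * i + t) (p * j + t') r ≡ false
      H*-disagree r r<p rewrite raw-H* i r<p t<p | raw-H* j r<p t'<p =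
        dec-false (r + i ≈? r + j) (λ eq → <⇒≢ i<j (≈⇒≡ i<p j<p (+-cancelˡ r eq)))
      H-rows : ∑[ a < p ] #[ l < p-1 ] agree (p * i + t) (p * j + t') (hRow a l) ≡ p-1
      H-rows with j <? p-1
      ... | yes j<p-1 = begin
        ∑[ a < p ] #[ l < p-1 ] agree (p * i + t) (p * j + t') (hRow a l)
          ≡⟨ ∑-cong p (λ a _ → #-cong p-1 (λ l l<p-1 →
               cong₂ (λ x y → does (x ≈? y)) (entry a i<p-1 l<p-1 t<p) (entry a j<p-1 l<p-1 t'<p))) ⟩
        ∑[ a < p ] #[ l < p-1 ] does (a * (i + 1) + (i * l + t) ≈? a * (j + 1) + (j * l + t'))
          ≡⟨ ∑-comm p p-1 (λ a l → boolToℕ (does (a * (i + 1) + (i * l + t) ≈? a * (j + 1) + (j * l + t')))) ⟩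
        ∑[ l < p-1 ] #[ a < p ] does (a * (i + 1) + (i * l + t) ≈? a * (j + 1) + (j * l + t'))
          ≡⟨ ∑-ones p-1 (λ l _ → #-affine-agree prime i+1≉j+1 (i * l + t) (j * l + t')) ⟩
        p-1 ∎
        where
        open ≡-Reasoning
        i<p-1 : i < p-1
        i<p-1 = <-trans i<j j<p-1
        entry : ∀ a {k l s} → k < p-1 → l < p-1 → s < p → raw (hRow a l) (p * k + s) ≡ a * (k + 1) + (k * l + s)
        entry a {k} k<p-1 l<p-1 s<p = trans (raw-H a k l<p-1 k<p-1 s<p) (+-assoc (a * (k + 1)) _ _)
        i+1≉j+1 : ¬ (i + 1 ≈ j + 1)
        i+1≉j+1 eq = <⇒≢ i<j (+-cancelʳ-≡ 1 i j (≈⇒≡ (<-trans (+-monoˡ-< 1 i<j) j+1<p) j+1<p eq))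
          where
          j+1<p : j + 1 < p
          j+1<p = subst (_< p) (+-comm 1 j) (s≤s j<p-1)
      ... | no j≮p-1 rewrite ≮p-1⇒≡p-1 j<p j≮p-1 = LastBlock.last-block-agreement i<j t<p t'<p

    first-row-agree : ∀ {i j t t'} → i < p → j < p → t < p → t' < p →
                      does (raw 0 (p * i + t) ≈? raw 0 (p * j + t')) ≡ does (i ≈? j)
    first-row-agree {i} {j} i<p j<p t<p t'<p = cong₂ (λ x y → does (x ≈? y)) (raw-H* i z<s t<p) (raw-H* j z<s t'<p)

    #-below-first-row : ∀ (g : ℕ → Bool) {n} → # (p * p) g ≡ boolToℕ (g 0) + n → #[ b < p * p ∸ 1 ] g (suc b) ≡ n
    #-below-first-row g = +-cancelˡ-≡ (boolToℕ (g 0)) _ _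

    agreement-below-first-row : ∀ {i j t t'} → i < p → j < p → t < p → t' < p → p * i + t ≢ p * j + t' →
                                #[ b < p * p ∸ 1 ] does (raw (suc b) (p * i + t) ≈? raw (suc b) (p * j + t')) ≡ p-1
    agreement-below-first-row {i} {j} {t} {t'} i<p j<p t<p t'<p distinct with <-cmp i j
    ... | tri< i<j i≢j _ = #-below-first-row (agree (p * i + t) (p * j + t'))
            (trans (cross-block-agreement i<j j<p t<p t'<p) (cong (λ x → boolToℕ x + p-1) (sym first-row)))
      where
      first-row : does (raw 0 (p * i + t) ≈? raw 0 (p * j + t')) ≡ false
      first-row = trans (first-row-agree i<p j<p t<p t'<p) (dec-false (i ≈? j) (λ eq → i≢j (≈⇒≡ i<p j<p eq)))
    ... | tri> _ j≢i j<i =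
      trans (#-cong (p * p ∸ 1) {λ b → agree (p * i + t) (p * j + t') (suc b)} {λ b → agree (p * j + t') (p * i + t) (suc b)}
                    (λ b _ → ≈?-comm (raw (suc b) (p * i + t)) (raw (suc b) (p * j + t'))))
            (#-below-first-row (agree (p * j + t') (p * i + t))
               (trans (cross-block-agreement j<i i<p t'<p t<p) (cong (λ x → boolToℕ x + p-1) (sym first-row))))
      where
      first-row : does (raw 0 (p * j + t') ≈? raw 0 (p * i + t)) ≡ false
      first-row = trans (first-row-agree j<p i<p t'<p t<p) (dec-false (j ≈? i) (λ eq → j≢i (sym (≈⇒≡ j<p i<p eq))))
    ... | tri≈ _ refl _ = #-below-first-row (agree (p * i + t) (p * i + t'))
            (trans (same-block-agreement i t<p t'<p (λ t≡t' → distinct (cong (p * i +_) t≡t')))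
                   (cong (λ x → boolToℕ x + p-1) (sym first-row)))
      where
      first-row : does (raw 0 (p * i + t) ≈? raw 0 (p * i + t')) ≡ true
      first-row = trans (first-row-agree i<p i<p t<p t'<p) (dec-true (i ≈? i) ≈-refl)

  count-≗ : ∀ {n} {f : Fin n → Bool} (g : ℕ → Bool) → (∀ i → f i ≡ g (toℕ i)) → count f ≡ # n g
  count-≗ {zero}  g f≗g = refl
  count-≗ {suc n} g f≗g = cong₂ _+_ (cong boolToℕ (f≗g Fin.zero)) (count-≗ (g ∘ suc) (f≗g ∘ Fin.suc))

  sumF-≗ : ∀ {n} {f : Fin n → ℕ} (g : ℕ → ℕ) → (∀ i → f i ≡ g (toℕ i)) → sumF f ≡ ∑ n g
  sumF-≗ {zero}  g f≗g = refl
  sumF-≗ {suc n} g f≗g = cong₂ _+_ (f≗g Fin.zero) (sumF-≗ (g ∘ suc) (f≗g ∘ Fin.suc))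

  ∣tabulate∣ : ∀ {n} (f : Fin n → Bool) → ∣ tabulate f ∣ ≡ count f
  ∣tabulate∣ {zero}  f = refl
  ∣tabulate∣ {suc n} f with f Fin.zero
  ... | true  = cong suc (∣tabulate∣ (f ∘ Fin.suc))
  ... | false = ∣tabulate∣ (f ∘ Fin.suc)

  ∈?-tabulate : ∀ {n} (f : Fin n → Bool) x → ⌊ x ∈? tabulate f ⌋ ≡ f x
  ∈?-tabulate f Fin.zero with f Fin.zero
  ... | true  = refl
  ... | false = refl
  ∈?-tabulate f (Fin.suc x) = trans (⌊⌋-map′ _ _ (x ∈? tabulate (f ∘ Fin.suc))) (∈?-tabulate (f ∘ Fin.suc) x)

  module Residues (p-1 : ℕ) where

    open Modular p-1

    toℕ-mod : ∀ A → toℕ (A mod p) ≡ A % p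
    toℕ-mod A = Fin.toℕ-fromℕ< (m%n<n A p)

    ⌊mod≟⌋ : ∀ A x → ⌊ A mod p Fin.≟ x ⌋ ≡ does (A ≈? toℕ x)
    ⌊mod≟⌋ A x = trans (isYes≗does (A mod p Fin.≟ x)) (does-⇔ (mk⇔ to from) (A mod p Fin.≟ x) (A ≈? toℕ x))
      where
      x%p≡x : toℕ x % p ≡ toℕ x
      x%p≡x = m<n⇒m%n≡m (Fin.toℕ<n x)
      to : A mod p ≡ x → A ≈ toℕ x
      to eq = mk≈ (trans (sym (toℕ-mod A)) (trans (cong toℕ eq) (sym x%p≡x)))
      from : A ≈ toℕ x → A mod p ≡ x
      from (mk≈ eq) = Fin.toℕ-injective (trans (toℕ-mod A) (trans eq x%p≡x))

    ⌊mod≟mod⌋ : ∀ A B → ⌊ A mod p Fin.≟ B mod p ⌋ ≡ does (A ≈? B)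
    ⌊mod≟mod⌋ A B = trans (⌊mod≟⌋ A (B mod p)) (cong (A % p ≡ᵇ_) (trans (cong (_% p) (toℕ-mod B)) (m%n%n≡m%n B p)))

  module FinProperties (q : ℕ) (prime : Prime (suc (suc (suc q)))) where

    open Modular (suc (suc q))
    open Residues (suc (suc q))
    open Entries q
    open Properties q prime

    data Blocked : Fin (p * p) → Set where
      blocked : (i t : Fin p) → Blocked (col i t)

    toBlocked : ∀ c → Blocked c
    toBlocked c = subst Blocked (Fin.combine-remQuot {p} p c)
                        (blocked (proj₁ (remQuot {p} p c)) (proj₂ (remQuot {p} p c)))

    toℕ-col : ∀ (i t : Fin p) → toℕ (col i t) ≡ p * toℕ i + toℕ t
    toℕ-col = Fin.toℕ-combine

    ⌊col≟⌋ : ∀ r (i t x : Fin p) → ⌊ M p r (col i t) Fin.≟ x ⌋ ≡ does (raw (toℕ r) (p * toℕ i + toℕ t) ≈? toℕ x)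
    ⌊col≟⌋ r i t x = trans (⌊mod≟⌋ (raw (toℕ r) (toℕ (col i t))) x)
                           (cong (λ c → does (raw (toℕ r) c ≈? toℕ x)) (toℕ-col i t))

    ⌊col≟col⌋ : ∀ r (i t j t' : Fin p) →
                ⌊ M p r (col i t) Fin.≟ M p r (col j t') ⌋ ≡ agree (p * toℕ i + toℕ t) (p * toℕ j + toℕ t') (toℕ r)
    ⌊col≟col⌋ r i t j t' = trans (⌊mod≟mod⌋ (raw (toℕ r) (toℕ (col i t))) (raw (toℕ r) (toℕ (col j t'))))
                                 (cong₂ (λ c c' → agree c c' (toℕ r)) (toℕ-col i t) (toℕ-col j t'))

    row-property : ∀ (x : Fin p) (r : Fin (p * p)) → count (λ c → ⌊ M p r c Fin.≟ x ⌋) ≡ p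
    row-property x r =
      trans (count-≗ {p * p} (λ c → does (raw (toℕ r) c ≈? toℕ x)) (λ c → ⌊mod≟⌋ (raw (toℕ r) (toℕ c)) x))
            (row-count (toℕ r) (toℕ x))

    column-property : ∀ (x : Fin p) (c : Fin (p * p)) → count (λ r → ⌊ M p r c Fin.≟ x ⌋) ≡ p
    column-property x c with toBlocked c
    ... | blocked i t =
      trans (count-≗ {p * p} (λ r → does (raw r (p * toℕ i + toℕ t) ≈? toℕ x)) (λ r → ⌊col≟⌋ r i t x))
            (column-count (toℕ x) (Fin.toℕ<n i) (Fin.toℕ<n t))

    same-block-property : ∀ (i t t' : Fin p) → t ≢ t' → count (λ r → ⌊ M p r (col i t) Fin.≟ M p r (col i t') ⌋) ≡ p
    same-block-property i t t' t≢t' =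
      trans (count-≗ {p * p} (agree (p * toℕ i + toℕ t) (p * toℕ i + toℕ t')) (λ r → ⌊col≟col⌋ r i t i t'))
            (same-block-agreement (toℕ i) (Fin.toℕ<n t) (Fin.toℕ<n t') (t≢t' ∘ Fin.toℕ-injective))

    cross-block-property : ∀ (i j : Fin p) → i Fin.< j → ∀ (t t' : Fin p) →
                           count (λ r → ⌊ M p r (col i t) Fin.≟ M p r (col j t') ⌋) ≡ p ∸ 1
    cross-block-property i j i<j t t' =
      trans (count-≗ {p * p} (agree (p * toℕ i + toℕ t) (p * toℕ j + toℕ t')) (λ r → ⌊col≟col⌋ r i t j t'))
            (cross-block-agreement i<j (Fin.toℕ<n j) (Fin.toℕ<n t) (Fin.toℕ<n t'))

    ∈-array : ∀ a b (i t : Fin p) → ⌊ col i t ∈? arrayOf p a b ⌋ ≡ does (raw (suc (toℕ b)) (p * toℕ i + toℕ t) ≈? toℕ a)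
    ∈-array a b i t = trans (∈?-tabulate (λ c → ⌊ M p (Fin.suc b) c Fin.≟ a ⌋) (col i t)) (⌊col≟⌋ (Fin.suc b) i t a)

    block-size : ∀ a b → ∣ arrayOf p a b ∣ ≡ p
    block-size a b = trans (∣tabulate∣ (λ c → ⌊ M p (Fin.suc b) c Fin.≟ a ⌋)) (row-property a (Fin.suc b))

    balanced : ∀ x y → x ≢ y → sumF (λ a → count (λ b → ⌊ x ∈? arrayOf p a b ⌋ ∧ ⌊ y ∈? arrayOf p a b ⌋)) ≡ p ∸ 1
    balanced x y x≢y with toBlocked x | toBlocked y
    ... | blocked i t | blocked j t' = begin
      sumF (λ a → count (λ b → ⌊ col i t ∈? arrayOf p a b ⌋ ∧ ⌊ col j t' ∈? arrayOf p a b ⌋))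
        ≡⟨ sumF-≗ (λ a → #[ b < p * p ∸ 1 ] (does (U b ≈? a) ∧ does (V b ≈? a)))
                  (λ a → count-≗ {p * p ∸ 1} (λ b → does (U b ≈? toℕ a) ∧ does (V b ≈? toℕ a))
                                  (λ b → cong₂ _∧_ (∈-array a b i t) (∈-array a b j t'))) ⟩
      ∑[ a < p ] #[ b < p * p ∸ 1 ] (does (U b ≈? a) ∧ does (V b ≈? a))
        ≡⟨ ∑-comm p (p * p ∸ 1) (λ a b → boolToℕ (does (U b ≈? a) ∧ does (V b ≈? a))) ⟩
      ∑[ b < p * p ∸ 1 ] #[ a < p ] (does (U b ≈? a) ∧ does (V b ≈? a))
        ≡⟨ ∑-cong (p * p ∸ 1) (λ b _ → #-common-value (U b) (V b)) ⟩
      #[ b < p * p ∸ 1 ] does (U b ≈? V b)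
        ≡⟨ agreement-below-first-row (Fin.toℕ<n i) (Fin.toℕ<n j) (Fin.toℕ<n t) (Fin.toℕ<n t') distinct ⟩
      p-1 ∎
      where
      open ≡-Reasoning
      U V : ℕ → ℕ
      U b = raw (suc b) (p * toℕ i + toℕ t)
      V b = raw (suc b) (p * toℕ j + toℕ t')
      distinct : p * toℕ i + toℕ t ≢ p * toℕ j + toℕ t'
      distinct eq = x≢y (Fin.toℕ-injective (trans (toℕ-col i t) (trans eq (sym (toℕ-col j t')))))

    column : ∀ b x → count (λ a → ⌊ x ∈? arrayOf p a b ⌋) ≡ 1
    column b x with toBlocked x
    ... | blocked i t =
      trans (count-≗ {p} (λ a → does (raw (suc (toℕ b)) (p * toℕ i + toℕ t) ≈? a)) (λ a → ∈-array a b i t))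
            (#-values (raw (suc (toℕ b)) (p * toℕ i + toℕ t)))

    row : ∀ a x → count (λ b → ⌊ x ∈? arrayOf p a b ⌋) ≤ p
    row a x with toBlocked x
    ... | blocked i t = begin
      count (λ b → ⌊ col i t ∈? arrayOf p a b ⌋)  ≡⟨ count-≗ {p * p ∸ 1} (λ b → g (suc b)) (λ b → ∈-array a b i t) ⟩
      #[ b < p * p ∸ 1 ] g (suc b)                ≤⟨ m≤n+m _ (boolToℕ (g 0)) ⟩
      # (p * p) g                                 ≡⟨ column-count (toℕ a) (Fin.toℕ<n i) (Fin.toℕ<n t) ⟩
      p                                           ∎
      where
      open ≤-Reasoning
      g : ℕ → Bool
      g r = does (raw r (p * toℕ i + toℕ t) ≈? toℕ a)

    isGBTD : IsGBTD p p (arrayOf p)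
    isGBTD = record { blockSize = block-size ; balanced = balanced ; column = column ; row = row }

open import Defs
open import Data.Nat using (ℕ; _≤_; _∸_; NonZero)
open import Data.Nat.Primality using (Prime)
open import Data.Fin using (Fin; _<_; _≟_)
open import Data.Product using (_×_)
open import Relation.Nullary.Decidable using (⌊_⌋)
open import Relation.Binary.PropositionalEquality using (_≡_; _≢_)
open import Data.Nat using (suc; s≤s; z≤n)
open import Data.Product using (_,_)
open Mp using (module FinProperties)

theorem1 : (p : ℕ) .{{_ : NonZero p}} → Prime p → 3 ≤ p →
    ((∀ (x : Fin p) (r : Fin (p Data.Nat.* p)) → count (λ c → ⌊ M p r c ≟ x ⌋) ≡ p)
     × (∀ (x : Fin p) (c : Fin (p Data.Nat.* p)) → count (λ r → ⌊ M p r c ≟ x ⌋) ≡ p))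
    × (∀ (i t t' : Fin p) → t ≢ t' →
         count (λ r → ⌊ M p r (col i t) ≟ M p r (col i t') ⌋) ≡ p)
    × (∀ (i j : Fin p) → i < j → ∀ (t t' : Fin p) →
         count (λ r → ⌊ M p r (col i t) ≟ M p r (col j t') ⌋) ≡ p ∸ 1)
    × IsGBTD p p (arrayOf p)
    × GBTD-exists p p
theorem1 (suc (suc (suc q))) p-prime (s≤s (s≤s (s≤s z≤n))) =
  (row-property , column-property) , same-block-property , cross-block-property , isGBTD , (arrayOf _ , isGBTD)
  where open FinProperties q p-prime
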